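{- Let $k\ge 3$ and let $D$ be a $k$-partite tournament. Then $\mathcal{N}(D)$ contains no induced path of length $5$; that is, $\mathcal{N}(D)$ is $P_6$-free.
   Context: $P_6$ denotes the path on $6$ vertices (length $5$). A $k$-partite tournament is an orientation of a complete $k$-partite graph with $k$ nonempty partite sets. The niche graph $\mathcal{N}(D)$ of a digraph $D$ has vertex set $V(D)$, and two distinct vertices are adjacent iff they have a common out-neighbor in $D$ or a common in-neighbor in $D$. -}

module Defs where

open import Data.Nat using (ℕ; suc)
open import Data.Fin using (Fin; toℕ)
open import Data.Product using (Σ; ∃; _×_)
open import Data.Sum using (_⊎_)
open import Relation.Binary.PropositionalEquality using (_≡_; _≢_)
open import Relation.Nullary using (¬_)

Digraph : ℕ → Set₁
Digraph n = Fin n → Fin n → Set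

record IsMultipartiteTournament {n : ℕ} (k : ℕ) (D : Digraph n) : Set₁ where
  field
    part        : Fin n → Fin k
    nonempty    : (i : Fin k) → ∃ λ v → part v ≡ i
    no-arc-in   : ∀ u v → D u v → part u ≢ part v
    some-arc    : ∀ u v → part u ≢ part v → D u v ⊎ D v u
    not-both    : ∀ u v → D u v → ¬ D v u

IsKPartiteTournament : {n : ℕ} → ℕ → Digraph n → Set₁
IsKPartiteTournament k D = IsMultipartiteTournament k D

NicheAdj : {n : ℕ} → Digraph n → Fin n → Fin n → Set
NicheAdj D u v = u ≢ v × ((∃ λ w → D u w × D v w) ⊎ (∃ λ w → D w u × D w v))

Consecutive : {m : ℕ} → Fin m → Fin m → Set
Consecutive i j = suc (toℕ i) ≡ toℕ j ⊎ suc (toℕ j) ≡ toℕ i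

record InducedPath {n : ℕ} (G : Fin n → Fin n → Set) (m : ℕ) : Set where
  field
    p         : Fin m → Fin n
    injective : ∀ i j → p i ≡ p j → i ≡ j
    adj→cons  : ∀ i j → G (p i) (p j) → Consecutive i j
    cons→adj  : ∀ i j → Consecutive i j → G (p i) (p j)

PathFree : {n : ℕ} → (Fin n → Fin n → Set) → ℕ → Set
PathFree G m = ¬ InducedPath G m

-- Call x, y independent if they are distinct and not adjacent in N(D). For an
-- independent triple, a vertex w outside the parts of all three has an arc to or
-- from each of them, and two of these arcs point the same way, giving a common
-- in- or out-neighbour. With a third part available, this forces the members of an
-- independent triple into distinct parts, and two triples sharing a pair to have
-- their remaining vertices in the same part. On an induced path q₀ … q₅ the triples
-- {q₀,q₃,q₅}, {q₁,q₃,q₅}, {q₀,q₂,q₅} put q₀, q₁ in one part and q₂, q₃ in another,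
-- and then a common neighbour of q₁, q₂ yields a common neighbour of one of the
-- independent pairs q₀q₂, q₁q₃, q₀q₃.
module Submission where

open import Defs
open import Data.Nat using (ℕ; _≤_; s≤s)
import Data.Nat as ℕ
open import Data.Fin using (Fin; zero; suc; #_; toℕ; _≟_)
open import Data.Product using (∃; _×_; _,_)
open import Data.Sum using (inj₁; inj₂)
open import Data.Empty using (⊥)
open import Function using (_∘_)
open import Relation.Nullary using (¬_; Dec)
open import Relation.Nullary.Decidable using (False; toWitnessFalse; decidable-stable; _⊎-dec_)
open import Relation.Binary.PropositionalEquality using (_≡_; _≢_; refl; sym; trans)

Independent : {n : ℕ} → (Fin n → Fin n → Set) → Fin n → Fin n → Set
Independent G x y = x ≢ y × ¬ G x y

consecutive? : {m : ℕ} (i j : Fin m) → Dec (Consecutive i j)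
consecutive? i j = (ℕ.suc (toℕ i) ℕ.≟ toℕ j) ⊎-dec (ℕ.suc (toℕ j) ℕ.≟ toℕ i)

module _ {n m : ℕ} {G : Fin n → Fin n → Set} (P : InducedPath G m) where
  open InducedPath P

  induced-path-independent : (i j : Fin m) →
    {False (consecutive? i j)} → {False (i ≟ j)} → Independent G (p i) (p j)
  induced-path-independent i j {i≁j} {i≢j} =
    toWitnessFalse i≢j ∘ injective i j , toWitnessFalse i≁j ∘ adj→cons i j

fin-avoid-two : {k : ℕ} → 3 ≤ k → (a b : Fin k) → ∃ λ c → c ≢ a × c ≢ b
fin-avoid-two (s≤s (s≤s (s≤s _))) zero          zero          = # 1 , (λ ()) , (λ ())
fin-avoid-two (s≤s (s≤s (s≤s _))) zero          (suc zero)    = # 2 , (λ ()) , (λ ())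
fin-avoid-two (s≤s (s≤s (s≤s _))) zero          (suc (suc b)) = # 1 , (λ ()) , (λ ())
fin-avoid-two (s≤s (s≤s (s≤s _))) (suc zero)    zero          = # 2 , (λ ()) , (λ ())
fin-avoid-two (s≤s (s≤s (s≤s _))) (suc (suc a)) zero          = # 1 , (λ ()) , (λ ())
fin-avoid-two (s≤s (s≤s (s≤s _))) (suc a)       (suc b)       = # 0 , (λ ()) , (λ ())

module NicheGraph {k n : ℕ} {D : Digraph n} (T : IsMultipartiteTournament k D) where
  open IsMultipartiteTournament T

  Indep : Fin n → Fin n → Set
  Indep = Independent (NicheAdj D)

  indep-sym : ∀ {x y} → Indep x y → Indep y x
  indep-sym (x≢y , x≁y) = x≢y ∘ sym , λ
    { (_ , inj₁ (w , yw , xw)) → x≁y (x≢y , inj₁ (w , xw , yw))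
    ; (_ , inj₂ (w , wy , wx)) → x≁y (x≢y , inj₂ (w , wx , wy)) }

  no-common-out-neighbour : ∀ {x y w} → Indep x y → D x w → D y w → ⊥
  no-common-out-neighbour (x≢y , x≁y) xw yw = x≁y (x≢y , inj₁ (_ , xw , yw))

  no-common-in-neighbour : ∀ {x y w} → Indep x y → D w x → D w y → ⊥
  no-common-in-neighbour (x≢y , x≁y) wx wy = x≁y (x≢y , inj₂ (_ , wx , wy))

  independent-triple-meets-every-part : ∀ {x y z w} →
    Indep x y → Indep y z → Indep x z →
    part w ≢ part x → part w ≢ part y → part w ≢ part z → ⊥
  independent-triple-meets-every-part {x} {y} {z} {w} xy yz xz wx wy wz
    with some-arc w x wx | some-arc w y wy | some-arc w z wz
  ... | inj₁ w→x | inj₁ w→y | _        = no-common-in-neighbour xy w→x w→y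
  ... | inj₂ x→w | inj₂ y→w | _        = no-common-out-neighbour xy x→w y→w
  ... | inj₁ w→x | inj₂ _   | inj₁ w→z = no-common-in-neighbour xz w→x w→z
  ... | inj₁ _   | inj₂ y→w | inj₂ z→w = no-common-out-neighbour yz y→w z→w
  ... | inj₂ _   | inj₁ w→y | inj₁ w→z = no-common-in-neighbour yz w→y w→z
  ... | inj₂ x→w | inj₁ _   | inj₂ z→w = no-common-out-neighbour xz x→w z→w

  independent-triple-distinct-parts : 3 ≤ k → ∀ {x y z} →
    Indep x y → Indep y z → Indep x z → part x ≢ part y
  independent-triple-distinct-parts k≥3 {x} {z = z} xy yz xz px≡py
    with fin-avoid-two k≥3 (part x) (part z)
  ... | c , c≢px , c≢pz with nonempty c
  ...   | w , refl =
    independent-triple-meets-every-part xy yz xz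
      c≢px (λ c≡py → c≢px (trans c≡py (sym px≡py))) c≢pz

  same-part-of-independent-triples : 3 ≤ k → ∀ {x y z u} →
    Indep x z → Indep x u → Indep y z → Indep y u → Indep z u → part x ≡ part y
  same-part-of-independent-triples k≥3 xz xu yz yu zu = decidable-stable (_ ≟ _) λ px≢py →
    independent-triple-meets-every-part yz zu yu px≢py
      (independent-triple-distinct-parts k≥3 xz zu xu)
      (independent-triple-distinct-parts k≥3 xu (indep-sym zu) xz)

  common-neighbour-transfers : ∀ {x y x′ y′} → NicheAdj D x y →
    part x′ ≡ part x → part y′ ≡ part y →
    Indep x′ y → Indep x y′ → Indep x′ y′ → ⊥
  common-neighbour-transfers (_ , inj₁ (w , x→w , y→w)) px′ py′ x′y xy′ x′y′
    with some-arc w _ (λ e → no-arc-in _ w x→w (sym (trans e px′)))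
       | some-arc w _ (λ e → no-arc-in _ w y→w (sym (trans e py′)))
  ... | inj₂ x′→w | _         = no-common-out-neighbour x′y x′→w y→w
  ... | inj₁ _    | inj₂ y′→w = no-common-out-neighbour xy′ x→w y′→w
  ... | inj₁ w→x′ | inj₁ w→y′ = no-common-in-neighbour x′y′ w→x′ w→y′
  common-neighbour-transfers (_ , inj₂ (w , w→x , w→y)) px′ py′ x′y xy′ x′y′
    with some-arc w _ (λ e → no-arc-in w _ w→x (trans e px′))
       | some-arc w _ (λ e → no-arc-in w _ w→y (trans e py′))
  ... | inj₁ w→x′ | _         = no-common-in-neighbour x′y w→x′ w→y
  ... | inj₂ _    | inj₁ w→y′ = no-common-in-neighbour xy′ w→x w→y′
  ... | inj₂ x′→w | inj₂ y′→w = no-common-out-neighbour x′y′ x′→w y′→w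

  -- Only the edge bc and the non-edges of the path a b c d plus isolated e are assumed.
  no-induced-P₄+K₁ : 3 ≤ k → ∀ {a b c d e} → NicheAdj D b c →
    Indep a c → Indep a d → Indep b d → Indep a e → Indep b e → Indep c e → Indep d e → ⊥
  no-induced-P₄+K₁ k≥3 bc ac ad bd ae be ce de =
    common-neighbour-transfers bc
      (same-part-of-independent-triples k≥3 ad ae bd be de)
      (same-part-of-independent-triples k≥3 (indep-sym ad) de (indep-sym ac) ce ae)
      ac bd ad

theorem4p4 : (k n : ℕ) → 3 ≤ k → (D : Digraph n) → IsKPartiteTournament k D →
    PathFree (NicheAdj D) 6
theorem4p4 k n k≥3 D T P =
  no-induced-P₄+K₁ k≥3 (cons→adj (# 1) (# 2) (inj₁ refl))
    (indep (# 0) (# 2)) (indep (# 0) (# 3)) (indep (# 1) (# 3))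
    (indep (# 0) (# 5)) (indep (# 1) (# 5)) (indep (# 2) (# 5)) (indep (# 3) (# 5))
  where
    open NicheGraph T
    open InducedPath P
    indep : (i j : Fin 6) → {False (consecutive? i j)} → {False (i ≟ j)} → Indep (p i) (p j)
    indep = induced-path-independent P
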